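{- Let $\mathrm{Pr}_T(x)$ be a provability predicate of $T$ satisfying condition $\mathbf{M}$. Then $\mathsf{MN}\subseteq \mathsf{PL}(\mathrm{Pr}_T)$. Furthermore, $\mathrm{Pr}_T(x)$ satisfies condition $\mathbf{D3}$ if and only if $\mathsf{MNF}\subseteq\mathsf{PL}(\mathrm{Pr}_T)$.
   Context: $T$ is a primitive recursively axiomatized consistent extension of Peano Arithmetic $\mathsf{PA}$ in the language of first-order arithmetic; $\ulcorner\varphi\urcorner$ denotes the numeral of the Gödel number of $\varphi$ under a fixed standard Gödel numbering. A provability predicate of $T$ is an arithmetical formula $\mathrm{Pr}_T(x)$ such that for every natural number $n$, $\mathsf{PA}\vdash\mathrm{Pr}_T(\overline{n})$ iff $n$ is the Gödel number of a theorem of $T$. Condition $\mathbf{M}$: for all formulas $\varphi,\psi$, if $T\vdash\varphi\to\psi$ then $T\vdash\mathrm{Pr}_T(\ulcorner\varphi\urcorner)\to\mathrm{Pr}_T(\ulcorner\psi\urcorner)$. Condition $\mathbf{D3}$: for all $\varphi$, $T\vdash\mathrm{Pr}_T(\ulcorner\varphi\urcorner)\to\mathrm{Pr}_T(\ulcorner\mathrm{Pr}_T(\ulcorner\varphi\urcorner)\urcorner)$. An arithmetical interpretation based on $\mathrm{Pr}_T$ is a map $f$ from modal formulas (built from propositional variables, $\bot$, $\to$, $\Box$) to arithmetical sentences with $f(\bot)$ being $0=1$, $f(A\to B)=f(A)\to f(B)$, $f(\Box A)=\mathrm{Pr}_T(\ulcorner f(A)\urcorner)$. $\mathsf{PL}(\mathrm{Pr}_T)$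 is the set of modal formulas $A$ such that $T\vdash f(A)$ for every arithmetical interpretation $f$ based on $\mathrm{Pr}_T$. The logic $\mathsf{MN}$ has as axioms all propositional tautologies in the modal language and rules Modus Ponens, Necessitation ($A/\Box A$) and RM ($A\to B/\Box A\to\Box B$); $\mathsf{MNF}$ is $\mathsf{MN}$ plus the axiom scheme $\Box A\to\Box\Box A$. -}

module Defs where

open import Data.Nat using (ℕ; zero; suc; _+_; _<_)
open import Data.Bool using (Bool; true; false; not; _∨_)
open import Data.Vec using (Vec; []; _∷_)
open import Data.Product using (Σ; _×_; _,_; proj₁; ∃)
open import Data.Empty using (⊥)
open import Relation.Binary.PropositionalEquality using (_≡_)
open import Relation.Nullary using (¬_)
open import Function.Bundles using (_⇔_)

data PR : ℕ → Set where
  pzero : PR 0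
  psucc : PR 1
  pproj : ∀ {k} → Data.Nat.ℕ → PR k          -- projection onto the i-th argument (0 if i ≥ k)
  pcomp : ∀ {k m} → PR m → Vec (PR k) m → PR k
  prec  : ∀ {k} → PR k → PR (suc (suc k)) → PR (suc k)

lookupℕ : ∀ {k} → Vec ℕ k → ℕ → ℕ
lookupℕ []       _       = 0
lookupℕ (x ∷ xs) zero    = x
lookupℕ (x ∷ xs) (suc i) = lookupℕ xs i

mutual
  evalPR : ∀ {k} → PR k → Vec ℕ k → ℕ
  evalPR pzero        _        = 0
  evalPR psucc        (x ∷ []) = suc x
  evalPR (pproj i)    xs       = lookupℕ xs i
  evalPR (pcomp g hs) xs       = evalPR g (evalPRs hs xs)
  evalPR (prec g h)   (n ∷ xs) = evalRec g h n xs

  evalPRs : ∀ {k m} → Vec (PR k) m → Vec ℕ k → Vec ℕ m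
  evalPRs []       xs = []
  evalPRs (h ∷ hs) xs = evalPR h xs ∷ evalPRs hs xs

  evalRec : ∀ {k} → PR k → PR (suc (suc k)) → ℕ → Vec ℕ k → ℕ
  evalRec g h zero    xs = evalPR g xs
  evalRec g h (suc n) xs = evalPR h (evalRec g h n xs ∷ n ∷ xs)

-- First-order arithmetic (language 0, S, +, ×, =; connectives ¬, →, ∀),
-- variables as de Bruijn indices.

data Term : Set where
  var  : ℕ → Term
  `0   : Term
  `S   : Term → Term
  _`+_ : Term → Term → Term
  _`*_ : Term → Term → Term

infix  7 _≐_
infixr 5 _⇒_

data Formula : Set where
  _≐_ : Term → Term → Formula
  ~_  : Formula → Formula
  _⇒_ : Formula → Formula → Formula
  ∀'  : Formula → Formula

renT : (ℕ → ℕ) → Term → Term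
renT ρ (var i)   = var (ρ i)
renT ρ `0        = `0
renT ρ (`S t)    = `S (renT ρ t)
renT ρ (s `+ t)  = renT ρ s `+ renT ρ t
renT ρ (s `* t)  = renT ρ s `* renT ρ t

liftR : (ℕ → ℕ) → ℕ → ℕ
liftR ρ zero    = zero
liftR ρ (suc i) = suc (ρ i)

renF : (ℕ → ℕ) → Formula → Formula
renF ρ (s ≐ t)  = renT ρ s ≐ renT ρ t
renF ρ (~ φ)    = ~ renF ρ φ
renF ρ (φ ⇒ ψ)  = renF ρ φ ⇒ renF ρ ψ
renF ρ (∀' φ)   = ∀' (renF (liftR ρ) φ)

shiftF : Formula → Formula
shiftF = renF suc

subT : (ℕ → Term) → Term → Term
subT σ (var i)   = σ i
subT σ `0        = `0
subT σ (`S t)    = `S (subT σ t)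
subT σ (s `+ t)  = subT σ s `+ subT σ t
subT σ (s `* t)  = subT σ s `* subT σ t

liftS : (ℕ → Term) → ℕ → Term
liftS σ zero    = var zero
liftS σ (suc i) = renT suc (σ i)

subF : (ℕ → Term) → Formula → Formula
subF σ (s ≐ t)  = subT σ s ≐ subT σ t
subF σ (~ φ)    = ~ subF σ φ
subF σ (φ ⇒ ψ)  = subF σ φ ⇒ subF σ ψ
subF σ (∀' φ)   = ∀' (subF (liftS σ) φ)

_⟨_⟩ : Formula → Term → Formula
φ ⟨ t ⟩ = subF σ φ
  where
  σ : ℕ → Term
  σ zero    = t
  σ (suc i) = var i

data WFT (n : ℕ) : Term → Set where
  wvar : ∀ {i} → i < n → WFT n (var i)
  w0   : WFT n `0
  wS   : ∀ {t} → WFT n t → WFT n (`S t)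
  w+   : ∀ {s t} → WFT n s → WFT n t → WFT n (s `+ t)
  w*   : ∀ {s t} → WFT n s → WFT n t → WFT n (s `* t)

data WF (n : ℕ) : Formula → Set where
  w≐ : ∀ {s t} → WFT n s → WFT n t → WF n (s ≐ t)
  w~ : ∀ {φ} → WF n φ → WF n (~ φ)
  w⇒ : ∀ {φ ψ} → WF n φ → WF n ψ → WF n (φ ⇒ ψ)
  w∀ : ∀ {φ} → WF (suc n) φ → WF n (∀' φ)

Sentence : Set
Sentence = Σ Formula (WF 0)

num : ℕ → Term
num zero    = `0
num (suc n) = `S (num n)

-- A fixed standard Gödel numbering (via the Cantor pairing function)

tri : ℕ → ℕ
tri zero    = zero
tri (suc n) = suc n + tri n

pair : ℕ → ℕ → ℕ
pair a b = tri (a + b) + b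

⌜_⌝ₜ : Term → ℕ
⌜ var i ⌝ₜ  = pair 0 i
⌜ `0 ⌝ₜ     = pair 1 0
⌜ `S t ⌝ₜ   = pair 2 ⌜ t ⌝ₜ
⌜ s `+ t ⌝ₜ = pair 3 (pair ⌜ s ⌝ₜ ⌜ t ⌝ₜ)
⌜ s `* t ⌝ₜ = pair 4 (pair ⌜ s ⌝ₜ ⌜ t ⌝ₜ)

⌜_⌝ : Formula → ℕ
⌜ s ≐ t ⌝ = pair 0 (pair ⌜ s ⌝ₜ ⌜ t ⌝ₜ)
⌜ ~ φ ⌝   = pair 1 ⌜ φ ⌝
⌜ φ ⇒ ψ ⌝ = pair 2 (pair ⌜ φ ⌝ ⌜ ψ ⌝)
⌜ ∀' φ ⌝  = pair 3 ⌜ φ ⌝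

-- Propositional tautologies of first-order formulas: true under every
-- truth assignment to the prime formulas (atomic and ∀-formulas).

truth : (Formula → Bool) → Formula → Bool
truth v (s ≐ t) = v (s ≐ t)
truth v (~ φ)   = not (truth v φ)
truth v (φ ⇒ ψ) = not (truth v φ) ∨ truth v ψ
truth v (∀' φ)  = v (∀' φ)

Tautology : Formula → Set
Tautology φ = ∀ (v : Formula → Bool) → truth v φ ≡ true

infix 3 _⊢_
data _⊢_ (Ax : Formula → Set) : Formula → Set where
  nonlog : ∀ {φ} → Ax φ → Ax ⊢ φ
  taut   : ∀ {φ} → Tautology φ → Ax ⊢ φ
  inst   : ∀ φ t → Ax ⊢ ∀' φ ⇒ φ ⟨ t ⟩
  dist   : ∀ φ ψ → Ax ⊢ ∀' (φ ⇒ ψ) ⇒ (∀' φ ⇒ ∀' ψ)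
  vac    : ∀ φ → Ax ⊢ φ ⇒ ∀' (shiftF φ)
  eqrefl : ∀ t → Ax ⊢ t ≐ t
  leib   : ∀ s t φ → Ax ⊢ s ≐ t ⇒ (φ ⟨ s ⟩ ⇒ φ ⟨ t ⟩)
  mp     : ∀ {φ ψ} → Ax ⊢ φ ⇒ ψ → Ax ⊢ φ → Ax ⊢ ψ
  gen    : ∀ {φ} → Ax ⊢ φ → Ax ⊢ ∀' φ

private
  x₀ x₁ : Term
  x₀ = var 0
  x₁ = var 1

stepF : Formula → Formula
stepF φ = subF σ φ
  where
  σ : ℕ → Term
  σ zero    = `S (var 0)
  σ (suc i) = var (suc i)

data PAAx : Formula → Set where
  pa1 : PAAx (∀' (~ (`S x₀ ≐ `0)))
  pa2 : PAAx (∀' (∀' (`S x₁ ≐ `S x₀ ⇒ x₁ ≐ x₀)))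
  pa3 : PAAx (∀' (x₀ `+ `0 ≐ x₀))
  pa4 : PAAx (∀' (∀' (x₁ `+ `S x₀ ≐ `S (x₁ `+ x₀))))
  pa5 : PAAx (∀' (x₀ `* `0 ≐ `0))
  pa6 : PAAx (∀' (∀' (x₁ `* `S x₀ ≐ (x₁ `* x₀) `+ x₁)))
  ind : ∀ φ → PAAx (φ ⟨ `0 ⟩ ⇒ (∀' (φ ⇒ stepF φ) ⇒ ∀' φ))

PA⊢_ : Formula → Set
PA⊢ φ = PAAx ⊢ φ

PRAxiomatized : (Formula → Set) → Set
PRAxiomatized Ax = Σ (PR 1) λ χ →
  ∀ n → (evalPR χ (n ∷ []) ≡ 0) ⇔ (Σ Formula λ φ → (⌜ φ ⌝ ≡ n) × Ax φ)

ExtendsPA : (Formula → Set) → Set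
ExtendsPA Ax = ∀ φ → PA⊢ φ → Ax ⊢ φ

Consistent : (Formula → Set) → Set
Consistent Ax = ¬ (Ax ⊢ `0 ≐ `S `0)

_[_] : Formula → ℕ → Formula
Pr [ n ] = Pr ⟨ num n ⟩

ProvabilityPredicate : (Formula → Set) → Formula → Set
ProvabilityPredicate Ax Pr =
  WF 1 Pr × (∀ n → (PA⊢ (Pr [ n ])) ⇔ (Σ Formula λ φ → (⌜ φ ⌝ ≡ n) × (Ax ⊢ φ)))

CondM : (Formula → Set) → Formula → Set
CondM Ax Pr = ∀ (φ ψ : Sentence) → Ax ⊢ proj₁ φ ⇒ proj₁ ψ →
  Ax ⊢ Pr [ ⌜ proj₁ φ ⌝ ] ⇒ Pr [ ⌜ proj₁ ψ ⌝ ]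

CondD3 : (Formula → Set) → Formula → Set
CondD3 Ax Pr = ∀ (φ : Sentence) →
  Ax ⊢ Pr [ ⌜ proj₁ φ ⌝ ] ⇒ Pr [ ⌜ Pr [ ⌜ proj₁ φ ⌝ ] ⌝ ]

infixr 5 _⇒ₘ_
data MFormula : Set where
  pv   : ℕ → MFormula
  ⊥ₘ   : MFormula
  _⇒ₘ_ : MFormula → MFormula → MFormula
  □    : MFormula → MFormula

truthₘ : (MFormula → Bool) → MFormula → Bool
truthₘ w (pv i)   = w (pv i)
truthₘ w ⊥ₘ       = false
truthₘ w (A ⇒ₘ B) = not (truthₘ w A) ∨ truthₘ w B
truthₘ w (□ A)    = w (□ A)

MTautology : MFormula → Set
MTautology A = ∀ (w : MFormula → Bool) → truthₘ w A ≡ true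

data MN⊢_ : MFormula → Set where
  taut : ∀ {A} → MTautology A → MN⊢ A
  mp   : ∀ {A B} → MN⊢ (A ⇒ₘ B) → MN⊢ A → MN⊢ B
  nec  : ∀ {A} → MN⊢ A → MN⊢ □ A
  rm   : ∀ {A B} → MN⊢ (A ⇒ₘ B) → MN⊢ (□ A ⇒ₘ □ B)

data MNF⊢_ : MFormula → Set where
  taut : ∀ {A} → MTautology A → MNF⊢ A
  four : ∀ A → MNF⊢ (□ A ⇒ₘ □ (□ A))
  mp   : ∀ {A B} → MNF⊢ (A ⇒ₘ B) → MNF⊢ A → MNF⊢ B
  nec  : ∀ {A} → MNF⊢ A → MNF⊢ □ A
  rm   : ∀ {A B} → MNF⊢ (A ⇒ₘ B) → MNF⊢ (□ A ⇒ₘ □ B)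

interp : Formula → (ℕ → Sentence) → MFormula → Formula
interp Pr v (pv i)   = proj₁ (v i)
interp Pr v ⊥ₘ       = `0 ≐ `S `0
interp Pr v (A ⇒ₘ B) = interp Pr v A ⇒ interp Pr v B
interp Pr v (□ A)    = Pr [ ⌜ interp Pr v A ⌝ ]

PL : (Formula → Set) → Formula → MFormula → Set
PL Ax Pr A = ∀ (v : ℕ → Sentence) → Ax ⊢ interp Pr v A

MN⊆PL : (Formula → Set) → Formula → Set
MN⊆PL Ax Pr = ∀ A → MN⊢ A → PL Ax Pr A

MNF⊆PL : (Formula → Set) → Formula → Set
MNF⊆PL Ax Pr = ∀ A → MNF⊢ A → PL Ax Pr A

-- Each rule of MN has an arithmetical counterpart that keeps PL(Pr) closed
-- under it. A modal tautology becomes a propositional tautology once the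
-- image 0 = 1 of ⊥ is known to be false, and PA refutes 0 = 1. Necessitation
-- holds because PA proves Pr(⌜φ⌝) for every theorem φ of T, and RM is exactly
-- condition M. Under D3 the axiom □A → □□A is valid as well; conversely D3 is
-- the instance of □p → □□p with p interpreted as the given sentence.
module Submission where

open import Defs
open import Data.Bool using (Bool; true; false; not; _∨_)
open import Data.Nat using (ℕ; zero; suc; _<_; s≤s; z≤n)
open import Data.Product using (_×_; _,_; proj₂)
open import Function.Bundles using (_⇔_; mk⇔; Equivalence)
open import Relation.Binary.PropositionalEquality using (_≡_; refl; sym; trans; cong₂)

renT-suc-wf : ∀ {m t} → WFT m t → WFT (suc m) (renT suc t)
renT-suc-wf (wvar i<m) = wvar (s≤s i<m)
renT-suc-wf w0         = w0
renT-suc-wf (wS t)     = wS (renT-suc-wf t)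
renT-suc-wf (w+ s t)   = w+ (renT-suc-wf s) (renT-suc-wf t)
renT-suc-wf (w* s t)   = w* (renT-suc-wf s) (renT-suc-wf t)

WFSub : ℕ → ℕ → (ℕ → Term) → Set
WFSub n m σ = ∀ {i} → i < n → WFT m (σ i)

liftS-wf : ∀ {n m σ} → WFSub n m σ → WFSub (suc n) (suc m) (liftS σ)
liftS-wf σ-wf {zero}  _         = wvar (s≤s z≤n)
liftS-wf σ-wf {suc i} (s≤s i<n) = renT-suc-wf (σ-wf i<n)

subT-wf : ∀ {n m σ t} → WFSub n m σ → WFT n t → WFT m (subT σ t)
subT-wf σ-wf (wvar i<n) = σ-wf i<n
subT-wf σ-wf w0         = w0
subT-wf σ-wf (wS t)     = wS (subT-wf σ-wf t)
subT-wf σ-wf (w+ s t)   = w+ (subT-wf σ-wf s) (subT-wf σ-wf t)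
subT-wf σ-wf (w* s t)   = w* (subT-wf σ-wf s) (subT-wf σ-wf t)

subF-wf : ∀ {n m σ φ} → WFSub n m σ → WF n φ → WF m (subF σ φ)
subF-wf σ-wf (w≐ s t) = w≐ (subT-wf σ-wf s) (subT-wf σ-wf t)
subF-wf σ-wf (w~ φ)   = w~ (subF-wf σ-wf φ)
subF-wf σ-wf (w⇒ φ ψ) = w⇒ (subF-wf σ-wf φ) (subF-wf σ-wf ψ)
subF-wf σ-wf (w∀ φ)   = w∀ (subF-wf (liftS-wf σ-wf) φ)

num-wf : ∀ n → WFT 0 (num n)
num-wf zero    = w0
num-wf (suc n) = wS (num-wf n)

⟨⟩-wf : ∀ {φ t} → WF 1 φ → WFT 0 t → WF 0 (φ ⟨ t ⟩)
⟨⟩-wf φ-wf t-wf = subF-wf σ-wf φ-wf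
  where
  σ-wf : ∀ {i} → i < 1 → WFT 0 _
  σ-wf {zero}  _ = t-wf
  σ-wf {suc i} (s≤s ())

interp-wf : ∀ {Pr} → WF 1 Pr → (v : ℕ → Sentence) → ∀ A → WF 0 (interp Pr v A)
interp-wf Pr-wf v (pv i)   = proj₂ (v i)
interp-wf Pr-wf v ⊥ₘ       = w≐ w0 (wS w0)
interp-wf Pr-wf v (A ⇒ₘ B) = w⇒ (interp-wf Pr-wf v A) (interp-wf Pr-wf v B)
interp-wf Pr-wf v (□ A)    = ⟨⟩-wf Pr-wf (num-wf _)

interpSentence : ∀ {Pr} → WF 1 Pr → (ℕ → Sentence) → MFormula → Sentence
interpSentence {Pr} Pr-wf v A = interp Pr v A , interp-wf Pr-wf v A

0≐1 : Formula
0≐1 = `0 ≐ `S `0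

contraposition-taut : ∀ φ ψ χ → Tautology ((φ ⇒ (ψ ⇒ χ)) ⇒ (ψ ⇒ (~ χ ⇒ ~ φ)))
contraposition-taut φ ψ χ val with truth val φ | truth val ψ | truth val χ
... | true  | true  | true  = refl
... | true  | true  | false = refl
... | true  | false | _     = refl
... | false | true  | true  = refl
... | false | true  | false = refl
... | false | false | _     = refl

-- Leibniz for x₀ ≐ 0 turns 0 = 1 into 1 = 0, which axiom pa1 refutes.
PA⊢¬0≐1 : PA⊢ ~ 0≐1
PA⊢¬0≐1 =
  mp (mp (mp (taut (contraposition-taut 0≐1 (`0 ≐ `0) (`S `0 ≐ `0)))
             (leib `0 (`S `0) (var 0 ≐ `0)))
         (eqrefl `0))
     (mp (inst _ `0) (nonlog pa1))

truthₘ-interp : ∀ Pr v (val : Formula → Bool) → val 0≐1 ≡ false →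
  ∀ A → truthₘ (λ B → truth val (interp Pr v B)) A ≡ truth val (interp Pr v A)
truthₘ-interp Pr v val 0≐1-false (pv i)   = refl
truthₘ-interp Pr v val 0≐1-false ⊥ₘ       = sym 0≐1-false
truthₘ-interp Pr v val 0≐1-false (A ⇒ₘ B) =
  cong₂ (λ a b → not a ∨ b) (truthₘ-interp Pr v val 0≐1-false A)
                            (truthₘ-interp Pr v val 0≐1-false B)
truthₘ-interp Pr v val 0≐1-false (□ A)    = refl

interp-taut : ∀ Pr v A → MTautology A → Tautology (~ 0≐1 ⇒ interp Pr v A)
interp-taut Pr v A A-taut val with val 0≐1 in 0≐1-value
... | true  = refl
... | false = trans (sym (truthₘ-interp Pr v val 0≐1-value A)) (A-taut _)

module _ {Ax : Formula → Set} {Pr : Formula} where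

  PL-taut : ExtendsPA Ax → ∀ A → MTautology A → PL Ax Pr A
  PL-taut ext A A-taut v = mp (taut (interp-taut Pr v A A-taut)) (ext _ PA⊢¬0≐1)

  PL-mp : ∀ A B → PL Ax Pr (A ⇒ₘ B) → PL Ax Pr A → PL Ax Pr B
  PL-mp A B A⇒B-valid A-valid v = mp (A⇒B-valid v) (A-valid v)

  PL-nec : ExtendsPA Ax → ProvabilityPredicate Ax Pr →
    ∀ A → PL Ax Pr A → PL Ax Pr (□ A)
  PL-nec ext (_ , represents) A A-valid v =
    ext _ (Equivalence.from (represents _) (interp Pr v A , refl , A-valid v))

  PL-rm : ProvabilityPredicate Ax Pr → CondM Ax Pr →
    ∀ A B → PL Ax Pr (A ⇒ₘ B) → PL Ax Pr (□ A ⇒ₘ □ B)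
  PL-rm (Pr-wf , _) M A B A⇒B-valid v =
    M (interpSentence Pr-wf v A) (interpSentence Pr-wf v B) (A⇒B-valid v)

  PL-four : ProvabilityPredicate Ax Pr → CondD3 Ax Pr →
    ∀ A → PL Ax Pr (□ A ⇒ₘ □ (□ A))
  PL-four (Pr-wf , _) D3 A v = D3 (interpSentence Pr-wf v A)

  PL-four⇒CondD3 : PL Ax Pr (□ (pv 0) ⇒ₘ □ (□ (pv 0))) → CondD3 Ax Pr
  PL-four⇒CondD3 four-valid φ = four-valid (λ _ → φ)

  module _ (ext : ExtendsPA Ax) (pp : ProvabilityPredicate Ax Pr) (M : CondM Ax Pr) where

    MN-sound : MN⊆PL Ax Pr
    MN-sound A            (taut A-taut)    = PL-taut ext A A-taut
    MN-sound B            (mp {A} ⊢A⇒B ⊢A) = PL-mp A B (MN-sound _ ⊢A⇒B) (MN-sound A ⊢A)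
    MN-sound (□ A)        (nec ⊢A)         = PL-nec ext pp A (MN-sound A ⊢A)
    MN-sound (□ A ⇒ₘ □ B) (rm ⊢A⇒B)        = PL-rm pp M A B (MN-sound _ ⊢A⇒B)

    MNF-sound : CondD3 Ax Pr → MNF⊆PL Ax Pr
    MNF-sound D3 A            (taut A-taut)    = PL-taut ext A A-taut
    MNF-sound D3 _            (four A)         = PL-four pp D3 A
    MNF-sound D3 B            (mp {A} ⊢A⇒B ⊢A) =
      PL-mp A B (MNF-sound D3 _ ⊢A⇒B) (MNF-sound D3 A ⊢A)
    MNF-sound D3 (□ A)        (nec ⊢A)         = PL-nec ext pp A (MNF-sound D3 A ⊢A)
    MNF-sound D3 (□ A ⇒ₘ □ B) (rm ⊢A⇒B)        = PL-rm pp M A B (MNF-sound D3 _ ⊢A⇒B)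

proposition4p1 : (Ax : Formula → Set) → PRAxiomatized Ax → ExtendsPA Ax → Consistent Ax →
    (Pr : Formula) → ProvabilityPredicate Ax Pr → CondM Ax Pr →
    MN⊆PL Ax Pr × (CondD3 Ax Pr ⇔ MNF⊆PL Ax Pr)
proposition4p1 Ax _ ext _ Pr pp M =
  MN-sound ext pp M ,
  mk⇔ (MNF-sound ext pp M) (λ MNF⊆PL → PL-four⇒CondD3 (MNF⊆PL _ (four (pv 0))))
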